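{- If $G$ is a simple connected graph with $\chi_L(G)=k\geq 3$, then $\Delta(G)\leq 4\cdot 3^{k-3}$, where $\Delta(G)$ is the maximum degree of $G$.
   Context: For a simple connected graph $G=(V,E)$, a $k$-coloring is a map $c:V\to\{1,\dots,k\}$ with adjacent vertices receiving different colors; $c^{ -1}(i)$ denotes the $i$-th color class, and $d(u,S)=\min_{v\in S}d(u,v)$. The color code of $v$ is $r_c(v)=(d(v,c^{ -1}(1)),\dots,d(v,c^{ -1}(k)))$. The coloring $c$ is a locating coloring if distinct vertices have distinct color codes. The locating chromatic number $\chi_L(G)$ is the least $k$ such that $G$ has a locating $k$-coloring. -}

module Defs where

open import Data.Nat using (ℕ; zero; suc; _+_; _≤_; _<_)
open import Data.Bool using (Bool; true; false; if_then_else_)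
open import Data.Fin using (Fin)
open import Data.List using (List; map; allFin)
open import Data.Nat.ListAction using (sum)
open import Data.Product using (Σ; ∃; _×_; _,_)
open import Relation.Binary.PropositionalEquality using (_≡_; _≢_)
open import Relation.Nullary using (¬_)
open import Function.Bundles using (_⇔_)

record Graph : Set where
  field
    n     : ℕ
    adj   : Fin n → Fin n → Bool
    sym   : ∀ u v → adj u v ≡ adj v u
    irrefl : ∀ v → adj v v ≡ false
open Graph public

data Walk (G : Graph) : Fin (n G) → Fin (n G) → ℕ → Set where
  here : ∀ {u} → Walk G u u 0
  step : ∀ {u w v m} → adj G u w ≡ true → Walk G w v m → Walk G u v (suc m)

Connected : Graph → Set
Connected G = ∀ u v → ∃ λ m → Walk G u v m

degree : (G : Graph) → Fin (n G) → ℕ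
degree G v = sum (map (λ w → if adj G v w then 1 else 0) (allFin (n G)))

MaxDegree≤ : Graph → ℕ → Set
MaxDegree≤ G b = ∀ v → degree G v ≤ b

IsColoring : (G : Graph) (k : ℕ) → (Fin (n G) → Fin k) → Set
IsColoring G k c = ∀ u v → adj G u v ≡ true → c u ≢ c v

-- d(u, c⁻¹(i)) = d : d is the minimum over vertices x of colour i of the
-- graph distance d(u,x), i.e. the minimum length of a walk from u to a
-- vertex of colour i.  (If the colour class is empty, no d satisfies this,
-- i.e. the distance is ∞.)
DistToClass : (G : Graph) {k : ℕ} → (Fin (n G) → Fin k) →
              Fin (n G) → Fin k → ℕ → Set
DistToClass G c u i d =
  (∃ λ x → c x ≡ i × Walk G u x d) ×
  (∀ x m → c x ≡ i → Walk G u x m → d ≤ m)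

SameCode : (G : Graph) {k : ℕ} → (Fin (n G) → Fin k) →
           Fin (n G) → Fin (n G) → Set
SameCode G c u v = ∀ i d → DistToClass G c u i d ⇔ DistToClass G c v i d

IsLocatingColoring : (G : Graph) (k : ℕ) → (Fin (n G) → Fin k) → Set
IsLocatingColoring G k c =
  IsColoring G k c × (∀ u v → SameCode G c u v → u ≡ v)

HasLocatingColoring : Graph → ℕ → Set
HasLocatingColoring G k = Σ (Fin (n G) → Fin k) (IsLocatingColoring G k)

LocChromNum≡ : Graph → ℕ → Set
LocChromNum≡ G k = HasLocatingColoring G k × (∀ j → j < k → ¬ HasLocatingColoring G j)

-- Fix v and compare the colour code of a neighbour w with that of v.  Since
-- |d(w,Cᵢ) − d(v,Cᵢ)| ≤ 1, each coordinate of r(w) is d(v,Cᵢ) − 1, d(v,Cᵢ) or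
-- d(v,Cᵢ) + 1; it is forced on the class of v, and on the s classes at distance 1
-- from v the value 0 occurs exactly once, at the class of w.  With r classes at
-- distance ≥ 2 from v and s + r ≤ k − 1, the neighbours' codes, which are pairwise
-- distinct, take at most s·2^(s−1)·3^r values, and
-- s·2^(s−1)·3^r ≤ (4/9)·3^(s+r) ≤ 4·3^(k−3) because 9·s·2^s ≤ 8·3^s.
module Submission where

open import Defs hiding (sym)
open import Data.Nat using (ℕ; zero; suc; _+_; _*_; _^_; _∸_; _≤_; _<_; z≤n; s≤s)
open import Data.Nat.Properties
open import Data.Nat.Induction using (<-rec)
open import Data.Nat.Tactic.RingSolver using (solve-∀)
open import Data.Bool using (Bool; true; false; if_then_else_)
open import Data.Bool.Properties using () renaming (_≟_ to _≟ᵇ_)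
open import Data.Fin using (Fin; zero; suc; toℕ; fromℕ<)
import Data.Fin.Properties as Fin
open import Data.Fin.Properties using (any?; toℕ<n; toℕ-fromℕ<; injective⇒≤) renaming (_≟_ to _≟ᶠ_)
open import Data.Vec using (Vec; []; _∷_; tabulate; lookup)
open import Data.Vec.Properties using (lookup∘tabulate)
import Data.Vec.Membership.Propositional as Vec
open import Data.Vec.Membership.Propositional.Properties using (∈-tabulate⁺)
open import Data.Vec.Relation.Unary.Any using () renaming (here to vhere; there to vthere)
open import Data.List using (List; []; _∷_; [_]; _++_; map; length; allFin; filter; cartesianProductWith)
open import Data.List.Properties using (length-++; length-map)
open import Data.Nat.ListAction using (sum)
open import Data.List.Membership.Propositional using (_∈_)
open import Data.List.Membership.Propositional.Properties using (∈-lookup; ∈-++⁺ˡ; ∈-++⁺ʳ; ∈-filter⁻)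
open import Data.List.Relation.Unary.Any using (here; there; index)
open import Data.List.Relation.Unary.Any.Properties using (lookup-index; cartesianProductWith⁺)
import Data.List.Relation.Unary.All as All
open import Data.List.Relation.Unary.AllPairs using (_∷_)
open import Data.List.Relation.Unary.Unique.Propositional using (Unique)
open import Data.List.Relation.Unary.Unique.Propositional.Properties using (allFin⁺; filter⁺)
open import Data.Product using (∃; _×_; _,_; proj₁; proj₂)
open import Data.Empty using (⊥-elim)
open import Function using (_∘_)
open import Function.Bundles using (mk⇔)
open import Relation.Binary.PropositionalEquality using (_≡_; _≢_; refl; sym; trans; cong; cong₂; subst; module ≡-Reasoning)
open import Relation.Nullary using (Dec; yes; no)
open import Relation.Nullary.Decidable using (map′; _×-dec_)
open import Relation.Unary using (Decidable)

Least : (ℕ → Set) → ℕ → Set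
Least P d = P d × (∀ m → P m → d ≤ m)

least : {P : ℕ → Set} → Decidable P → ∀ {m} → P m → ∃ (Least P)
least {P} P? {m} = <-rec (λ m → P m → ∃ (Least P)) search m
  where
  search : ∀ m → (∀ {j} → j < m → P j → ∃ (Least P)) → P m → ∃ (Least P)
  search m below pm with any? (λ (j : Fin m) → P? (toℕ j))
  ... | yes (j , pj) = below (toℕ<n j) pj
  ... | no none = m , pm , λ j pj → ≮⇒≥ λ j<m →
          none (fromℕ< j<m , subst P (sym (toℕ-fromℕ< j<m)) pj)

Unique⇒lookup-injective : ∀ {A : Set} {xs : List A} → Unique xs →
                   ∀ {i j} → Data.List.lookup xs i ≡ Data.List.lookup xs j → i ≡ j
Unique⇒lookup-injective (_ ∷ _) {zero} {zero} _ = refl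
Unique⇒lookup-injective (x∉ ∷ _) {zero} {suc j} eq = ⊥-elim (All.lookup x∉ (∈-lookup j) eq)
Unique⇒lookup-injective (x∉ ∷ _) {suc i} {zero} eq = ⊥-elim (All.lookup x∉ (∈-lookup i) (sym eq))
Unique⇒lookup-injective (_ ∷ u) {suc i} {suc j} eq = cong suc (Unique⇒lookup-injective u eq)

length-≤-of-injection : ∀ {A B : Set} (f : A → B) {xs : List A} {ys : List B} → Unique xs →
                        (∀ {x y} → x ∈ xs → y ∈ xs → f x ≡ f y → x ≡ y) →
                        (∀ {x} → x ∈ xs → f x ∈ ys) → length xs ≤ length ys
length-≤-of-injection f {xs} {ys} unique injective into = injective⇒≤ position-injective
  where
  position : Fin (length xs) → Fin (length ys)
  position i = index (into (∈-lookup i))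

  image : ∀ i → f (Data.List.lookup xs i) ≡ Data.List.lookup ys (position i)
  image i = lookup-index (into (∈-lookup i))

  position-injective : ∀ {i j} → position i ≡ position j → i ≡ j
  position-injective {i} {j} eq = Unique⇒lookup-injective unique (injective (∈-lookup i) (∈-lookup j)
    (trans (image i) (trans (cong (Data.List.lookup ys) eq) (sym (image j)))))

sum-indicator≡length-filter : ∀ {A : Set} (p : A → Bool) (xs : List A) →
  sum (map (λ x → if p x then 1 else 0) xs) ≡ length (filter (λ x → p x ≟ᵇ true) xs)
sum-indicator≡length-filter p [] = refl
sum-indicator≡length-filter p (x ∷ xs) with p x
... | true = cong suc (sum-indicator≡length-filter p xs)
... | false = sum-indicator≡length-filter p xs

length-cartesianProductWith : ∀ {A B C : Set} (f : A → B → C) (xs : List A) (ys : List B) →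
  length (cartesianProductWith f xs ys) ≡ length xs * length ys
length-cartesianProductWith f [] ys = refl
length-cartesianProductWith f (x ∷ xs) ys = begin
  length (map (f x) ys ++ cartesianProductWith f xs ys)   ≡⟨ length-++ (map (f x) ys) ⟩
  length (map (f x) ys) + length (cartesianProductWith f xs ys)
    ≡⟨ cong₂ _+_ (length-map (f x) ys) (length-cartesianProductWith f xs ys) ⟩
  length ys + length xs * length ys                       ∎
  where open ≡-Reasoning

-- Relative to v, coordinate i of a neighbour's code is encoded by
-- suc d(w,Cᵢ) ∸ d(v,Cᵢ) ∈ {0,1,2}; the slot of i records whether d(v,Cᵢ) is 0, 1 or ≥ 2,
-- and digits lists the encodings that remain possible.
data Slot : Set where
  fixed near far : Slot

slotOf : ℕ → Slot
slotOf zero = fixed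
slotOf (suc zero) = near
slotOf (suc (suc _)) = far

digits : Slot → List ℕ
digits fixed = [ 2 ]
digits near = 1 ∷ 2 ∷ []
digits far = 0 ∷ 1 ∷ 2 ∷ []

≤2⇒∈digits-far : ∀ {d} → d ≤ 2 → d ∈ digits far
≤2⇒∈digits-far z≤n = here refl
≤2⇒∈digits-far (s≤s z≤n) = there (here refl)
≤2⇒∈digits-far (s≤s (s≤s z≤n)) = there (there (here refl))

shift∈digits : ∀ a b → a ≤ suc b → b ≤ suc a → 1 ≤ b → suc b ∸ a ∈ digits (slotOf a)
shift∈digits zero (suc zero) _ _ _ = here refl
shift∈digits zero (suc (suc _)) _ (s≤s ()) _
shift∈digits (suc zero) (suc zero) _ _ _ = here refl
shift∈digits (suc zero) (suc (suc zero)) _ _ _ = there (here refl)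
shift∈digits (suc zero) (suc (suc (suc _))) _ (s≤s (s≤s ())) _
shift∈digits (suc (suc a)) b _ b≤3+a _ = ≤2⇒∈digits-far (m≤n+o⇒m∸n≤o (suc b) (2 + a)
  (≤-trans (s≤s b≤3+a) (≤-reflexive (cong (λ x → 2 + x) (+-comm 2 a)))))

prepend : ∀ {k} → List ℕ → List (Vec ℕ k) → List (Vec ℕ (suc k))
prepend = cartesianProductWith _∷_

∈-prepend : ∀ {k d ds xs} {P : List (Vec ℕ k)} → d ∈ ds → xs ∈ P → d ∷ xs ∈ prepend ds P
∈-prepend = cartesianProductWith⁺ _∷_ (cong₂ _∷_)

-- patterns ts true: exactly one near coordinate is 0; patterns ts false: none is.
patterns : ∀ {k} → Vec Slot k → Bool → List (Vec ℕ k)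
patterns [] false = [ [] ]
patterns [] true = []
patterns (s ∷ ts) false = prepend (digits s) (patterns ts false)
patterns (near ∷ ts) true = prepend [ 0 ] (patterns ts false) ++ prepend (digits near) (patterns ts true)
patterns (fixed ∷ ts) true = prepend (digits fixed) (patterns ts true)
patterns (far ∷ ts) true = prepend (digits far) (patterns ts true)

tabulate-∈-patterns-false : ∀ {k} (slot : Fin k → Slot) (δ : Fin k → ℕ) →
  (∀ i → δ i ∈ digits (slot i)) → tabulate δ ∈ patterns (tabulate slot) false
tabulate-∈-patterns-false {zero} slot δ allowed = here refl
tabulate-∈-patterns-false {suc k} slot δ allowed =
  ∈-prepend (allowed zero) (tabulate-∈-patterns-false (slot ∘ suc) (δ ∘ suc) (allowed ∘ suc))

tabulate-∈-patterns-true : ∀ {k} (slot : Fin k → Slot) (δ : Fin k → ℕ) (j : Fin k) →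
  slot j ≡ near → δ j ≡ 0 → (∀ i → i ≢ j → δ i ∈ digits (slot i)) →
  tabulate δ ∈ patterns (tabulate slot) true
tabulate-∈-patterns-true slot δ zero slot-near δ-zero allowed rewrite slot-near | δ-zero =
  ∈-++⁺ˡ (∈-prepend {ds = [ 0 ]} (here refl) (tabulate-∈-patterns-false (slot ∘ suc) (δ ∘ suc) (λ i → allowed (suc i) (λ ()))))
tabulate-∈-patterns-true slot δ (suc j) slot-near δ-zero allowed
  with slot zero | allowed zero (λ ())
     | tabulate-∈-patterns-true (slot ∘ suc) (δ ∘ suc) j slot-near δ-zero
         (λ i i≢j → allowed (suc i) (i≢j ∘ Fin.suc-injective))
... | fixed | d∈ | rest = ∈-prepend d∈ rest
... | near  | d∈ | rest = ∈-++⁺ʳ (prepend [ 0 ] (patterns (tabulate (slot ∘ suc)) false)) (∈-prepend d∈ rest)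
... | far   | d∈ | rest = ∈-prepend d∈ rest

nearCount farCount : ∀ {k} → Vec Slot k → ℕ
nearCount [] = 0
nearCount (near ∷ ts) = suc (nearCount ts)
nearCount (_ ∷ ts) = nearCount ts
farCount [] = 0
farCount (far ∷ ts) = suc (farCount ts)
farCount (_ ∷ ts) = farCount ts

x*[y*z]≡y*[x*z] : ∀ x y z → x * (y * z) ≡ y * (x * z)
x*[y*z]≡y*[x*z] = solve-∀

length-prepend : ∀ {k} ds (P : List (Vec ℕ k)) → length (prepend ds P) ≡ length ds * length P
length-prepend = length-cartesianProductWith _∷_

length-patterns-false : ∀ {k} (ts : Vec Slot k) →
  length (patterns ts false) ≡ 2 ^ nearCount ts * 3 ^ farCount ts
length-patterns-false [] = refl
length-patterns-false (s ∷ ts) = trans (length-prepend (digits s) F) (by-slot s)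
  where
  F = patterns ts false
  a = 2 ^ nearCount ts
  b = 3 ^ farCount ts
  IH : length F ≡ a * b
  IH = length-patterns-false ts
  by-slot : ∀ s → length (digits s) * length F ≡ 2 ^ nearCount (s ∷ ts) * 3 ^ farCount (s ∷ ts)
  by-slot fixed = trans (+-identityʳ (length F)) IH
  by-slot near = trans (cong (2 *_) IH) (sym (*-assoc 2 a b))
  by-slot far = trans (cong (3 *_) IH) (x*[y*z]≡y*[x*z] 3 a b)

length-patterns-true : ∀ {k} (ts : Vec Slot k) →
  2 * length (patterns ts true) ≡ nearCount ts * 2 ^ nearCount ts * 3 ^ farCount ts
length-patterns-true [] = refl
length-patterns-true (fixed ∷ ts) =
  trans (cong (2 *_) (trans (length-prepend (digits fixed) (patterns ts true))
                            (+-identityʳ (length (patterns ts true)))))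
        (length-patterns-true ts)
length-patterns-true (far ∷ ts) = begin
  2 * length (prepend (digits far) T) ≡⟨ cong (2 *_) (length-prepend (digits far) T) ⟩
  2 * (3 * length T)                  ≡⟨ x*[y*z]≡y*[x*z] 2 3 (length T) ⟩
  3 * (2 * length T)                  ≡⟨ cong (3 *_) (length-patterns-true ts) ⟩
  3 * (s * a * b)                     ≡⟨ x*[y*z]≡y*[x*z] 3 (s * a) b ⟩
  s * a * (3 * b)                     ∎
  where open ≡-Reasoning
        T = patterns ts true
        s = nearCount ts
        a = 2 ^ s
        b = 3 ^ farCount ts
length-patterns-true (near ∷ ts) = begin
  2 * length (prepend [ 0 ] F ++ prepend (digits near) T)
    ≡⟨ cong (2 *_) (trans (length-++ (prepend [ 0 ] F))
                          (cong₂ _+_ (length-prepend [ 0 ] F) (length-prepend (digits near) T))) ⟩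
  2 * (1 * length F + 2 * length T)   ≡⟨ regroup (length F) (length T) ⟩
  2 * length F + 2 * (2 * length T)   ≡⟨ cong₂ (λ x y → 2 * x + 2 * y) (length-patterns-false ts) (length-patterns-true ts) ⟩
  2 * (a * b) + 2 * (s * a * b)       ≡⟨ collect s a b ⟩
  suc s * (2 * a) * b                 ∎
  where open ≡-Reasoning
        F = patterns ts false
        T = patterns ts true
        s = nearCount ts
        a = 2 ^ s
        b = 3 ^ farCount ts
        regroup : ∀ x y → 2 * (1 * x + 2 * y) ≡ 2 * x + 2 * (2 * y)
        regroup = solve-∀
        collect : ∀ s a b → 2 * (a * b) + 2 * (s * a * b) ≡ suc s * (2 * a) * b
        collect = solve-∀

9*[n*2^n]≤8*3^n : ∀ n → 9 * (n * 2 ^ n) ≤ 8 * 3 ^ n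
9*[n*2^n]≤8*3^n 0 = z≤n
9*[n*2^n]≤8*3^n 1 = m≤m+n 18 6
9*[n*2^n]≤8*3^n 2 = ≤-refl
9*[n*2^n]≤8*3^n (suc (suc (suc t))) = begin
  9 * ((3 + t) * (2 * a))   ≤⟨ m≤m+n _ (9 * t * a) ⟩
  9 * ((3 + t) * (2 * a)) + 9 * t * a ≡⟨ expand t a ⟩
  3 * (9 * ((2 + t) * a))   ≤⟨ *-monoʳ-≤ 3 (9*[n*2^n]≤8*3^n (suc (suc t))) ⟩
  3 * (8 * 3 ^ (2 + t))     ≡⟨ x*[y*z]≡y*[x*z] 3 8 (3 ^ (2 + t)) ⟩
  8 * 3 ^ (3 + t)           ∎
  where open ≤-Reasoning
        a = 2 ^ (2 + t)
        expand : ∀ t a → 9 * ((3 + t) * (2 * a)) + 9 * t * a ≡ 3 * (9 * ((2 + t) * a))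
        expand = solve-∀

near+far≤length : ∀ {k} (ts : Vec Slot k) → nearCount ts + farCount ts ≤ k
near+far≤length [] = z≤n
near+far≤length (fixed ∷ ts) = m≤n⇒m≤1+n (near+far≤length ts)
near+far≤length (near ∷ ts) = s≤s (near+far≤length ts)
near+far≤length (far ∷ ts) = ≤-trans (≤-reflexive (+-suc (nearCount ts) _)) (s≤s (near+far≤length ts))

near+far<length : ∀ {k} {ts : Vec Slot k} → fixed Vec.∈ ts → nearCount ts + farCount ts < k
near+far<length {ts = fixed ∷ ts} (vhere refl) = s≤s (near+far≤length ts)
near+far<length {ts = s ∷ ts} (vthere fixed∈ts) = by-slot s
  where
  IH = near+far<length fixed∈ts
  by-slot : ∀ s → nearCount (s ∷ ts) + farCount (s ∷ ts) < suc _
  by-slot fixed = m<n⇒m<1+n IH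
  by-slot near = s≤s IH
  by-slot far = ≤-trans (s≤s (≤-reflexive (+-suc (nearCount ts) _))) (s≤s IH)

length-patterns-true≤ : ∀ {k} (ts : Vec Slot k) → nearCount ts + farCount ts < k →
                        length (patterns ts true) ≤ 4 * 3 ^ (k ∸ 3)
length-patterns-true≤ {k} ts s+r<k = *-cancelˡ-≤ 18 (begin
  18 * L                    ≡⟨ *-assoc 9 2 L ⟩
  9 * (2 * L)               ≡⟨ cong (9 *_) (length-patterns-true ts) ⟩
  9 * (s * 2 ^ s * 3 ^ r)   ≡⟨ sym (*-assoc 9 (s * 2 ^ s) (3 ^ r)) ⟩
  9 * (s * 2 ^ s) * 3 ^ r   ≤⟨ *-monoˡ-≤ (3 ^ r) (9*[n*2^n]≤8*3^n s) ⟩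
  8 * 3 ^ s * 3 ^ r         ≡⟨ *-assoc 8 (3 ^ s) (3 ^ r) ⟩
  8 * (3 ^ s * 3 ^ r)       ≡⟨ cong (8 *_) (sym (^-distribˡ-+-* 3 s r)) ⟩
  8 * 3 ^ (s + r)           ≤⟨ *-monoʳ-≤ 8 (^-monoʳ-≤ 3 s+r≤2+e) ⟩
  8 * 3 ^ (2 + e)           ≡⟨ regroup (3 ^ e) ⟩
  18 * (4 * 3 ^ e)          ∎)
  where open ≤-Reasoning
        L = length (patterns ts true)
        s = nearCount ts
        r = farCount ts
        e = k ∸ 3
        regroup : ∀ x → 8 * (3 * (3 * x)) ≡ 18 * (4 * x)
        regroup = solve-∀
        s+r≤2+e : s + r ≤ 2 + e
        s+r≤2+e = ≤-pred (≤-trans s+r<k (m≤n+m∸n k 3))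

module ClassDistances (G : Graph) {k : ℕ} (c : Fin (n G) → Fin k) where

  walk? : ∀ m u x → Dec (Walk G u x m)
  walk? zero u x = map′ (λ { refl → here }) (λ { here → refl }) (u ≟ᶠ x)
  walk? (suc m) u x = map′ (λ (w , e , p) → step e p) (λ { (step e p) → _ , e , p })
                           (any? λ w → (adj G u w ≟ᵇ true) ×-dec walk? m w x)

  Reaches : Fin (n G) → Fin k → ℕ → Set
  Reaches u i m = ∃ λ x → c x ≡ i × Walk G u x m

  dist-exists : Connected G → ∀ u {x} i → c x ≡ i → ∃ (DistToClass G c u i)
  dist-exists conn u {x} i cx with least {Reaches u i} (λ m → any? λ y → (c y ≟ᶠ i) ×-dec walk? m u y)
                                         (x , cx , proj₂ (conn u x))
  ... | d , reach , minimal = d , reach , λ y m cy w → minimal m (y , cy , w)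

  dist-unique : ∀ {u i a b} → DistToClass G c u i a → DistToClass G c u i b → a ≡ b
  dist-unique ((x , cx , w) , min) ((y , cy , w′) , min′) = ≤-antisym (min y _ cy w′) (min′ x _ cx w)

  dist-self : ∀ u → DistToClass G c u (c u) 0
  dist-self u = (u , refl , here) , λ _ _ _ _ → z≤n

  dist-zero : ∀ {u i} → DistToClass G c u i 0 → c u ≡ i
  dist-zero ((x , cx , here) , _) = cx

  dist-adjacent : ∀ {u w i a b} → adj G u w ≡ true →
                  DistToClass G c u i a → DistToClass G c w i b → a ≤ suc b
  dist-adjacent u~w (_ , min) ((x , cx , w) , _) = min x _ cx (step u~w w)

module NeighbourCodes (G : Graph) (conn : Connected G) {k : ℕ} (c : Fin (n G) → Fin k)
                      (proper : IsColoring G k c) (v : Fin (n G)) where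
  open ClassDistances G c

  Inhabited : Fin k → Set
  Inhabited i = ∃ λ x → c x ≡ i

  inhabited? : ∀ i → Dec (Inhabited i)
  inhabited? i = any? λ x → c x ≟ᶠ i

  dist : Fin (n G) → (i : Fin k) → Inhabited i → ℕ
  dist u i (_ , cx) = proj₁ (dist-exists conn u i cx)

  dist-spec : ∀ u i ne → DistToClass G c u i (dist u i ne)
  dist-spec u i (_ , cx) = proj₂ (dist-exists conn u i cx)

  -- An empty colour class is at distance ∞ from every vertex; it is treated as a
  -- fixed coordinate with the constant encoding 2.
  slotAt : ∀ i → Dec (Inhabited i) → Slot
  slotAt i (yes ne) = slotOf (dist v i ne)
  slotAt i (no _) = fixed

  shiftAt : Fin (n G) → ∀ i → Dec (Inhabited i) → ℕ
  shiftAt w i (yes ne) = suc (dist w i ne) ∸ dist v i ne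
  shiftAt w i (no _) = 2

  slot : Fin k → Slot
  slot i = slotAt i (inhabited? i)

  shift : Fin (n G) → Fin k → ℕ
  shift w i = shiftAt w i (inhabited? i)

  fixed∈slots : fixed Vec.∈ tabulate slot
  fixed∈slots = subst (Vec._∈ tabulate slot) slot-own-colour (∈-tabulate⁺ slot (c v))
    where
    slot-own-colour : slot (c v) ≡ fixed
    slot-own-colour with inhabited? (c v)
    ... | yes ne rewrite dist-unique (dist-spec v (c v) ne) (dist-self v) = refl
    ... | no _ = refl

  module _ {w} (v~w : adj G v w ≡ true) where
    w~v : adj G w v ≡ true
    w~v = trans (Graph.sym G w v) v~w

    shift-∈-digits : ∀ i → i ≢ c w → shift w i ∈ digits (slot i)
    shift-∈-digits i i≢cw with inhabited? i
    ... | no _ = here refl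
    ... | yes ne = shift∈digits (dist v i ne) b (dist-adjacent v~w (dist-spec v i ne) (dist-spec w i ne))
                     (dist-adjacent w~v (dist-spec w i ne) (dist-spec v i ne)) (n≢0⇒n>0 b≢0)
      where
      b = dist w i ne
      b≢0 : b ≢ 0
      b≢0 b≡0 = i≢cw (sym (dist-zero (subst (DistToClass G c w i) b≡0 (dist-spec w i ne))))

    own-colour : slot (c w) ≡ near × shift w (c w) ≡ 0
    own-colour with inhabited? (c w)
    ... | no empty = ⊥-elim (empty (w , refl))
    ... | yes ne = at-distance-one a≡1 b≡0
      where
      b≡0 : dist w (c w) ne ≡ 0
      b≡0 = dist-unique (dist-spec w (c w) ne) (dist-self w)
      a≢0 : dist v (c w) ne ≢ 0
      a≢0 a≡0 = proper v w v~w (dist-zero (subst (DistToClass G c v (c w)) a≡0 (dist-spec v (c w) ne)))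
      a≡1 : dist v (c w) ne ≡ 1
      a≡1 = ≤-antisym (dist-adjacent v~w (dist-spec v (c w) ne) (dist-self w)) (n≢0⇒n>0 a≢0)
      at-distance-one : ∀ {a b} → a ≡ 1 → b ≡ 0 → slotOf a ≡ near × suc b ∸ a ≡ 0
      at-distance-one refl refl = refl , refl

    code-∈-patterns : tabulate (shift w) ∈ patterns (tabulate slot) true
    code-∈-patterns = tabulate-∈-patterns-true slot (shift w) (c w)
                        (proj₁ own-colour) (proj₂ own-colour) shift-∈-digits

  equal-shift⇒same-dist : ∀ {w w′} → adj G v w ≡ true → adj G v w′ ≡ true → ∀ i (h : Dec (Inhabited i)) →
             shiftAt w i h ≡ shiftAt w′ i h → ∀ {d} → DistToClass G c w i d → DistToClass G c w′ i d
  equal-shift⇒same-dist _ _ i (no empty) _ ((x , cx , _) , _) = ⊥-elim (empty (x , cx))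
  equal-shift⇒same-dist {w} {w′} v~w v~w′ i (yes ne) eq {d} D =
    subst (DistToClass G c w′ i) (sym d≡) (dist-spec w′ i ne)
    where
    d≡ : d ≡ dist w′ i ne
    d≡ = trans (dist-unique D (dist-spec w i ne))
               (suc-injective (∸-cancelʳ-≡ (dist-adjacent v~w (dist-spec v i ne) (dist-spec w i ne))
                                           (dist-adjacent v~w′ (dist-spec v i ne) (dist-spec w′ i ne)) eq))

  same-code : ∀ {w w′} → adj G v w ≡ true → adj G v w′ ≡ true →
              tabulate (shift w) ≡ tabulate (shift w′) → SameCode G c w w′
  same-code {w} {w′} v~w v~w′ eq i d =
    mk⇔ (equal-shift⇒same-dist v~w v~w′ i (inhabited? i) shift≡)
        (equal-shift⇒same-dist v~w′ v~w i (inhabited? i) (sym shift≡))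
    where
    shift≡ : shift w i ≡ shift w′ i
    shift≡ = trans (sym (lookup∘tabulate (shift w) i))
                   (trans (cong (λ xs → lookup xs i) eq) (lookup∘tabulate (shift w′) i))

  degree≤length-patterns : (∀ u u′ → SameCode G c u u′ → u ≡ u′) →
                           degree G v ≤ length (patterns (tabulate slot) true)
  degree≤length-patterns locating = begin
    degree G v         ≡⟨ sum-indicator≡length-filter (adj G v) (allFin (n G)) ⟩
    length neighbours  ≤⟨ length-≤-of-injection (tabulate ∘ shift) (filter⁺ adjacent? (allFin⁺ (n G)))
                            (λ p q eq → locating _ _ (same-code (adjacent p) (adjacent q) eq))
                            (code-∈-patterns ∘ adjacent) ⟩
    length (patterns (tabulate slot) true) ∎
    where
    open ≤-Reasoning
    adjacent? = λ w → adj G v w ≟ᵇ true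
    neighbours = filter adjacent? (allFin (n G))
    adjacent : ∀ {w} → w ∈ neighbours → adj G v w ≡ true
    adjacent p = proj₂ (∈-filter⁻ adjacent? {xs = allFin (n G)} p)

theorem5 : (G : Graph) (k : ℕ) → Connected G → LocChromNum≡ G k → 3 ≤ k →
           MaxDegree≤ G (4 * 3 ^ (k ∸ 3))
theorem5 G k conn ((c , proper , locating) , _) _ v =
  ≤-trans (degree≤length-patterns locating) (length-patterns-true≤ (tabulate slot) (near+far<length fixed∈slots))
  where open NeighbourCodes G conn c proper v
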